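{- Assume the setting described in the context, with $G$ even-hole-free, and suppose a set $Y=\{y_1,\dots,y_{k+1}\}$ exists. Let $(i,B,C)$ be a separation of the bi-tree $T=(V,A,E)$ such that $k+1\in C$, the bi-tree $T\setminus C$ is a bi-spider, and $i$ is either a leaf of the red in-arborescence of $T\setminus B$ or a leaf of the white tree of $T\setminus B$. Then for every $j\in B\setminus\{i\}$ and every $s\in C$, the vertex $y_j$ has no neighbour in $X_s$.
   Context: Setting: $k\ge1$ is an integer and $G$ is a finite simple graph whose vertex set is partitioned into $k+1$ cliques $X_1,\dots,X_{k+1}$ (parts) and a set $W$ of $k$ vertices $w_{a_1b_1},\dots,w_{a_kb_k}$ with $a_i\ne b_i\in\{1,\dots,k+1\}$; $W$ is an independent set. Each $w_{a_ib_i}$ is adjacent to every vertex of $X_{a_i}$ and $X_{b_i}$ and to no vertex of any other part. $E=\{\{a_i,b_i\}:1\le i\le k\}$ forms a tree (white tree) on $V=\{1,\dots,k+1\}$ in which $k+1$ is a leaf. For $1\le i\le k$ the part $X_i$ contains a distinguished vertex $x_i$, and $\{x_1,\dots,x_k\}$ is independent. For each $1\le i\le k$ there is $r(i)\ne i$ in $V$ such that $x_i$ is adjacent to every vertex of $X_{r(i)}\setminus\{x_{r(i)}\}$ and has no neighbour in $X_j$ for $j\notin\{i,r(i)\}$. $A=\{(i,r(i)):1\le i\le k\}$ forms an in-arborescence (red) on $V$ rooted at $k+1$. $T=(V,A,E)$ is then a bi-tree. A set $Y$ is an independent set $\{y_1,\dots,y_{k+1}\}$ of $G$ with $y_i\in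 X_i$ for all $i$ and $y_i\ne x_i$ for $i\le k$. A graph is even-hole-free if it contains no induced cycle of even length at least four. A separation of $T$ is a triple $(v,X,Y')$ such that $V$ is partitioned into nonempty sets $\{v\}$, $X$, $Y'$ and no white edge and no red arc has one end in $X$ and the other in $Y'$; then $T\setminus Y'$ denotes the bi-tree induced on $X\cup\{v\}$ (white edges and red arcs with both ends in $X\cup\{v\}$), and $T\setminus X$ symmetrically. A leaf is a vertex of degree one in the underlying undirected tree. A bi-path is a bi-tree $(V',A',E')$ with $m\ge2$ vertices admitting an ordering $v_1,\dots,v_m$ and an integer $1\le t\le m-1$ such that $A'=\{v_1v_2,\dots,v_{m-1}v_m\}$, $v_1v_m\in E'$, $\{v_1v_2,\dots,v_1v_t\}\subseteq E'$ if $t\ge2$, and $\{v_{t+1}v_m,\dots,v_{m-1}v_m\}\subseteq E'$ if $t\le m-2$ (its root is $v_m$). A bi-spider is a bi-tree obtained from bi-paths by iteratively gluing them at the root vertex (identifying their roots), i.e. a union of bi-paths pairwise sharing only their common root. -}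

module Defs where

open import Data.Nat using (ℕ; zero; suc; _≤_; _<_)
open import Data.Nat.Divisibility using (_∣_)
open import Data.Fin using (Fin; toℕ; inject₁; fromℕ)
open import Data.Bool using (Bool; true; false)
open import Data.Sum using (_⊎_; inj₁; inj₂)
open import Data.Product using (Σ; ∃; _×_; _,_)
open import Data.Unit using (⊤)
open import Relation.Nullary using (¬_)
open import Relation.Binary.PropositionalEquality using (_≡_; _≢_)
open import Function.Bundles using (_⇔_)

record Graph : Set where
  field
    n      : ℕ
    adj    : Fin n → Fin n → Bool
    sym    : ∀ u v → adj u v ≡ adj v u
    irrefl : ∀ v → adj v v ≡ false

module _ (G : Graph) where
  open Graph G

  CycNb : (m : ℕ) → Fin m → Fin m → Set
  CycNb m p q = (toℕ q ≡ suc (toℕ p)) ⊎ (toℕ p ≡ suc (toℕ q))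
              ⊎ ((toℕ p ≡ 0 × suc (toℕ q) ≡ m) ⊎ (toℕ q ≡ 0 × suc (toℕ p) ≡ m))

  InducedCycle : ℕ → Set
  InducedCycle m = Σ (Fin m → Fin n) λ c →
    (∀ p q → c p ≡ c q → p ≡ q) ×
    (∀ p q → (adj (c p) (c q) ≡ true) ⇔ CycNb m p q)

  EvenHoleFree : Set
  EvenHoleFree = ∀ m → 4 ≤ m → 2 ∣ m → ¬ InducedCycle m

-- Edge systems: m (undirected) edges, edge e joining u e and v e,
-- on the vertex set Fin nv.  Subgraphs are induced by vertex predicates.

module EdgeSys {nv m : ℕ} (u v : Fin m → Fin nv) where

  Inside : (Fin nv → Set) → Fin m → Set
  Inside S e = S (u e) × S (v e)

  data Conn (F : Fin m → Set) : Fin nv → Fin nv → Set where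
    here : ∀ {x} → Conn F x x
    fwd  : ∀ {x} e → F e → Conn F (v e) x → Conn F (u e) x
    bwd  : ∀ {x} e → F e → Conn F (u e) x → Conn F (v e) x

  -- the subgraph induced on S is a tree: connected, and every edge is a
  -- bridge (minimally connected)
  IsTreeOn : (Fin nv → Set) → Set
  IsTreeOn S =
    (∀ x y → S x → S y → Conn (Inside S) x y) ×
    (∀ e → Inside S e → ¬ Conn (λ e' → Inside S e' × e' ≢ e) (u e) (v e))

  Incident : Fin nv → Fin m → Set
  Incident x e = (u e ≡ x) ⊎ (v e ≡ x)

  IsLeafOn : (Fin nv → Set) → Fin nv → Set
  IsLeafOn S x = S x × ∃ λ e → Inside S e × Incident x e ×
    (∀ e' → Inside S e' → Incident x e' → e' ≡ e)

-- Bi-trees on V = Fin (suc k) (vertex k+1 of the paper is fromℕ k,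
-- vertex i ≤ k of the paper is inject₁ of an element of Fin k).
-- White edges: {a e, b e}, e : Fin k.  Red arcs: (inject₁ j, r j), j : Fin k.

module BiTree (k : ℕ) (a b r : Fin k → Fin (suc k)) where

  V : Set
  V = Fin (suc k)

  module W = EdgeSys a b
  module R = EdgeSys inject₁ r

  data DReach (S : V → Set) (ρ : V) : V → Set where
    root : DReach S ρ ρ
    step : ∀ j → S (inject₁ j) → S (r j) → DReach S ρ (r j) → DReach S ρ (inject₁ j)

  -- the sub-bi-tree induced on S is a bi-tree with root ρ: its white
  -- edges form a tree on S and its red arcs form an in-arborescence on S
  -- rooted at ρ (underlying tree, all arcs directed towards ρ)
  IsBiTreeOn : (V → Set) → V → Set
  IsBiTreeOn S ρ = S ρ × W.IsTreeOn S × R.IsTreeOn S × (∀ x → S x → DReach S ρ x)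

  HasWhite : V → V → Set
  HasWhite x y = ∃ λ e → (a e ≡ x × b e ≡ y) ⊎ (a e ≡ y × b e ≡ x)

  HasRed : V → V → Set
  HasRed x y = ∃ λ j → inject₁ j ≡ x × r j ≡ y

  -- candidate bi-path: ordering v_1,…,v_m (as ord 0,…,ord (m-1)) and t
  record PathData : Set where
    field
      m   : ℕ
      ord : Fin m → V
      t   : ℕ

  module _ (P : PathData) where
    open PathData P

    Rng : V → Set
    Rng x = ∃ λ p → ord p ≡ x

    Consec : Fin m → Fin m → Set
    Consec p q = toℕ q ≡ suc (toℕ p)

    IsFirst : Fin m → Set
    IsFirst p = toℕ p ≡ 0

    IsLast : Fin m → Set
    IsLast p = suc (toℕ p) ≡ m

    IsBiPathWithRoot : V → Set
    IsBiPathWithRoot ρ =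
      2 ≤ m × 1 ≤ t × t < m ×
      (∀ p q → ord p ≡ ord q → p ≡ q) ×
      (∀ p → IsLast p → ord p ≡ ρ) ×
      IsBiTreeOn Rng ρ ×
      -- A' = {v_1v_2, …, v_{m-1}v_m}
      (∀ j → R.Inside Rng j ⇔
         (∃ λ p → ∃ λ q → Consec p q × ord p ≡ inject₁ j × ord q ≡ r j)) ×
      (∀ p q → Consec p q → HasRed (ord p) (ord q)) ×
      -- v_1 v_m ∈ E'
      (∀ p q → IsFirst p → IsLast q → HasWhite (ord p) (ord q)) ×
      -- v_1 v_2, …, v_1 v_t ∈ E'   (positions 1 … t-1)
      (∀ p q → IsFirst p → 1 ≤ toℕ q → suc (toℕ q) ≤ t → HasWhite (ord p) (ord q)) ×
      -- v_{t+1} v_m, …, v_{m-1} v_m ∈ E'   (positions t … m-2)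
      (∀ p q → IsLast q → t ≤ toℕ p → suc (suc (toℕ p)) ≤ m → HasWhite (ord p) (ord q))

  IsBiSpiderOn : (V → Set) → Set
  IsBiSpiderOn S = ∃ λ (ρ : V) → ∃ λ (q : ℕ) → Σ (Fin (suc q) → PathData) λ P →
    (∀ l → IsBiPathWithRoot (P l) ρ) ×
    (∀ x → S x ⇔ (∃ λ l → Rng (P l) x)) ×
    (∀ l l' x → l ≢ l' → Rng (P l) x → Rng (P l') x → x ≡ ρ) ×
    (∀ j → R.Inside S j → ∃ λ l → R.Inside (Rng (P l)) j) ×
    (∀ e → W.Inside S e → ∃ λ l → W.Inside (Rng (P l)) e)

  -- separations (v, X, Y') of T, encoded by a labelling of V
  data Side : Set where
    sv sX sY : Side

  IsSeparation : V → (V → Side) → Set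
  IsSeparation v side =
    (∀ x → side x ≡ sv ⇔ x ≡ v) ×
    (∃ λ x → side x ≡ sX) ×
    (∃ λ x → side x ≡ sY) ×
    (∀ e → ¬ (side (a e) ≡ sX × side (b e) ≡ sY)) ×
    (∀ e → ¬ (side (a e) ≡ sY × side (b e) ≡ sX)) ×
    (∀ j → ¬ (side (inject₁ j) ≡ sX × side (r j) ≡ sY)) ×
    (∀ j → ¬ (side (inject₁ j) ≡ sY × side (r j) ≡ sX))

record Setting (k : ℕ) : Set where
  field
    k≥1   : 1 ≤ k
    G     : Graph
  open Graph G public
  field
    -- partition of V(G) into parts X_1..X_{k+1} and W
    loc   : Fin n → Fin (suc k) ⊎ Fin k
    w     : Fin k → Fin n
    w-loc : ∀ x i → loc x ≡ inj₂ i ⇔ x ≡ w i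
    a b   : Fin k → Fin (suc k)
    a≢b   : ∀ i → a i ≢ b i
    clique : ∀ s x y → loc x ≡ inj₁ s → loc y ≡ inj₁ s → x ≢ y → adj x y ≡ true
    W-indep : ∀ i j → adj (w i) (w j) ≡ false
    w-adj : ∀ i s x → loc x ≡ inj₁ s → adj (w i) x ≡ true ⇔ (s ≡ a i ⊎ s ≡ b i)
    x     : Fin k → Fin n
    x-loc : ∀ i → loc (x i) ≡ inj₁ (inject₁ i)
    x-indep : ∀ i j → adj (x i) (x j) ≡ false
    r     : Fin k → Fin (suc k)
    r≢    : ∀ i → r i ≢ inject₁ i
    x-red : ∀ i z → loc z ≡ inj₁ (r i) → (∀ j → inject₁ j ≡ r i → z ≢ x j) → adj (x i) z ≡ true
    x-non : ∀ i s z → loc z ≡ inj₁ s → s ≢ inject₁ i → s ≢ r i → adj (x i) z ≡ false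
    bitree : BiTree.IsBiTreeOn k a b r (λ _ → ⊤) (fromℕ k)
    leaf   : EdgeSys.IsLeafOn a b (λ _ → ⊤) (fromℕ k)

record YSet {k : ℕ} (σ : Setting k) : Set where
  open Setting σ
  field
    y     : Fin (suc k) → Fin n
    y-loc : ∀ s → loc (y s) ≡ inj₁ s
    y-indep : ∀ s s' → adj (y s) (y s') ≡ false
    y≢x   : ∀ i → y (inject₁ i) ≢ x i

module Submission where

-- Suppose y_j sees z ∈ X_s.  Since i is a leaf of T \ B, C is connected
-- in that colour, which yields an induced path of G from y_{r(i)} to y_s using
-- only vertices attached to C; prepending x_i gives an induced path L₀ on
-- which z has a first neighbour.  If that first neighbour sits at an odd
-- position, the red chain from j down to i (entirely in B) extends L₀ to an
-- induced path starting at y_j; if it sits at an even position, the bi-spider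
-- T \ C (whose root must be i) joins j to i by one or two white edges, giving
-- another such extension.  In both cases z together with a prefix of the
-- extended path is an induced cycle of even length ≥ 4.

open import Defs
open import Data.Bool using (true; false)
open import Data.Bool.Properties using () renaming (¬-not to ≢true⇒false)
open import Data.Empty using (⊥; ⊥-elim)
open import Data.Fin using (Fin; fromℕ; inject₁; toℕ; lower₁) renaming (zero to fz; suc to fs)
open import Data.Fin.Properties
  using (toℕ-injective; toℕ-fromℕ; inject₁-lower₁; inject₁-injective; toℕ<n) renaming (_≟_ to _≟F_)
open import Data.List using (List; []; _∷_; _++_; length; lookup)
open import Data.List.Membership.Propositional.Properties using (∈-lookup)
open import Data.List.Properties using (++-assoc; length-++)
open import Data.List.Relation.Unary.All as All using (All; []; _∷_)
open import Data.List.Relation.Unary.All.Properties using (++⁻ˡ)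
open import Data.List.Relation.Unary.Any as Any using (Any; here; there)
open import Data.Nat using (ℕ; zero; suc; _+_; _≤_; s≤s; z≤n; parity; _≟_; _≤?_)
open import Data.Nat.Divisibility using (_∣_; divides)
open import Data.Nat.Properties
  using (suc-injective; +-comm; n≢0⇒n>0; ≤∧≢⇒<; ≤-pred; ≰⇒>; ≤-refl; ≤-trans; m≤n⇒m≤1+n)
open import Data.Parity.Base using (Parity; 0ℙ; 1ℙ; _⁻¹)
open import Data.Parity.Properties using (⁻¹-involutive; suc-homo-⁻¹)
open import Data.Product using (Σ; ∃; _×_; _,_; proj₁; proj₂)
open import Data.Sum as Sum using (_⊎_; inj₁; inj₂)
open import Data.Sum.Properties using (inj₁-injective; inj₂-injective)
open import Data.Unit using (⊤; tt)
open import Function using (_∘_)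
open import Function.Bundles using (_⇔_; mk⇔; Equivalence)
open import Relation.Binary.PropositionalEquality using (_≡_; _≢_; refl; sym; trans; cong; subst; subst₂)
open import Relation.Nullary using (¬_; Dec; yes; no)

false≢true : false ≢ true
false≢true ()

first-position : ∀ {m} → 2 ≤ m → Σ (Fin m) λ p → toℕ p ≡ 0
first-position (s≤s _) = fz , refl

last-position : ∀ {m} → 2 ≤ m → Σ (Fin m) λ p → suc (toℕ p) ≡ m
last-position {suc m} _ = fromℕ m , cong suc (toℕ-fromℕ m)

first≢last : ∀ {m} (2≤m : 2 ≤ m) → toℕ (proj₁ (first-position 2≤m)) ≢ toℕ (proj₁ (last-position 2≤m))
first≢last {suc (suc m)} (s≤s (s≤s _)) e with trans e (toℕ-fromℕ (suc m))
... | ()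

-- Induced paths, walks and holes in an arbitrary graph
module GraphFacts (G : Graph) where
  open Graph G renaming (sym to adj-sym)

  Apart : Fin n → Fin n → Set
  Apart g h = adj g h ≡ false × g ≢ h

  Apart-sym : ∀ {g h} → Apart g h → Apart h g
  Apart-sym (g≁h , g≢h) = trans (adj-sym _ _) g≁h , g≢h ∘ sym

  no-loop : ∀ g → adj g g ≢ true
  no-loop g g~g with trans (sym (irrefl g)) g~g
  ... | ()

  adj⇒≢apart : ∀ {g h h'} → adj g h ≡ true → Apart g h' → h ≢ h'
  adj⇒≢apart g~h (g≁h' , _) refl with trans (sym g~h) g≁h'
  ... | ()

  InducedPath : List (Fin n) → Set
  InducedPath []          = ⊤
  InducedPath (g ∷ [])    = ⊤
  InducedPath (g ∷ h ∷ L) = adj g h ≡ true × g ≢ h × All (Apart g) L × InducedPath (h ∷ L)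

  induced-head-distinct : ∀ h T → InducedPath (h ∷ T) → All (h ≢_) T
  induced-head-distinct h []      _                 = []
  induced-head-distinct h (g ∷ T) (_ , h≢g , hT , _) = h≢g ∷ All.map proj₂ hT

  induced-prefix : ∀ A {B} → InducedPath (A ++ B) → InducedPath A
  induced-prefix []          _                    = tt
  induced-prefix (g ∷ [])    _                    = tt
  induced-prefix (g ∷ h ∷ A) (g~h , g≢h , gA , ip) =
    g~h , g≢h , ++⁻ˡ A gA , induced-prefix (h ∷ A) ip

  Consecutive : ∀ {m} → Fin m → Fin m → Set
  Consecutive p q = (toℕ q ≡ suc (toℕ p)) ⊎ (toℕ p ≡ suc (toℕ q))

  induced-lookup : ∀ L → InducedPath L → ∀ (p q : Fin (length L)) →
    (lookup L p ≡ lookup L q → p ≡ q) × (adj (lookup L p) (lookup L q) ≡ true ⇔ Consecutive p q)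
  induced-lookup (g ∷ []) _ fz fz = (λ _ → refl) , mk⇔ (⊥-elim ∘ no-loop g) λ { (inj₁ ()) ; (inj₂ ()) }
  induced-lookup (g ∷ h ∷ L) _ fz fz = (λ _ → refl) , mk⇔ (⊥-elim ∘ no-loop g) λ { (inj₁ ()) ; (inj₂ ()) }
  induced-lookup (g ∷ h ∷ L) (g~h , g≢h , _ , _) fz (fs fz) =
    ⊥-elim ∘ g≢h , mk⇔ (λ _ → inj₁ refl) (λ _ → g~h)
  induced-lookup (g ∷ h ∷ L) (g~h , g≢h , _ , _) (fs fz) fz =
    ⊥-elim ∘ g≢h ∘ sym , mk⇔ (λ _ → inj₂ refl) (λ _ → trans (adj-sym _ _) g~h)
  induced-lookup (g ∷ h ∷ L) (_ , _ , gL , _) fz (fs (fs q)) =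
    ⊥-elim ∘ proj₂ g⋯q ,
    mk⇔ (⊥-elim ∘ false≢true ∘ trans (sym (proj₁ g⋯q))) λ { (inj₁ ()) ; (inj₂ ()) }
    where g⋯q = All.lookup gL (∈-lookup q)
  induced-lookup (g ∷ h ∷ L) (_ , _ , gL , _) (fs (fs p)) fz =
    ⊥-elim ∘ proj₂ g⋯p ∘ sym ,
    mk⇔ (⊥-elim ∘ false≢true ∘ trans (sym (proj₁ (Apart-sym g⋯p)))) λ { (inj₁ ()) ; (inj₂ ()) }
    where g⋯p = All.lookup gL (∈-lookup p)
  induced-lookup (g ∷ h ∷ L) (_ , _ , _ , ip) (fs p) (fs q) =
    cong fs ∘ inj , mk⇔ (shift ∘ Equivalence.to eqv) (Equivalence.from eqv ∘ unshift)
    where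
    rec = induced-lookup (h ∷ L) ip p q
    inj = proj₁ rec
    eqv = proj₂ rec
    shift : Consecutive p q → Consecutive {suc (length (h ∷ L))} (fs p) (fs q)
    shift = Sum.map (cong suc) (cong suc)
    unshift : Consecutive {suc (length (h ∷ L))} (fs p) (fs q) → Consecutive p q
    unshift = Sum.map suc-injective suc-injective

  module Walks (P : Fin n → Set) where

    data Walk : Fin n → Fin n → Set where
      stop : ∀ {g} → P g → Walk g g
      move : ∀ {g h l} → P g → adj g h ≡ true → Walk h l → Walk g l

    -- the number of moves of a walk (the measure for shortcutting)
    steps : ∀ {g l} → Walk g l → ℕ
    steps (stop _)     = zero
    steps (move _ _ w) = suc (steps w)

    On OnTail : ∀ {g l} → Walk g l → Fin n → Set
    On (stop {g} _)     v = v ≡ g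
    On (move {g} _ _ w) v = (v ≡ g) ⊎ On w v
    OnTail (stop _)     v = ⊥
    OnTail (move _ _ w) v = On w v

    on-walk-inside : ∀ {g l v} (w : Walk g l) → On w v → P v
    on-walk-inside (stop p)     refl        = p
    on-walk-inside (move p _ _) (inj₁ refl) = p
    on-walk-inside (move _ _ w) (inj₂ o)    = on-walk-inside w o

    on-start-or-tail : ∀ {g l v} (w : Walk g l) → On w v → (v ≡ g) ⊎ OnTail w v
    on-start-or-tail (stop _)     e        = inj₁ e
    on-start-or-tail (move _ _ _) (inj₁ e) = inj₁ e
    on-start-or-tail (move _ _ _) (inj₂ o) = inj₂ o

    Touches : Fin n → Fin n → Set
    Touches g v = (v ≡ g) ⊎ (adj g v ≡ true)

    touches? : ∀ g v → Touches g v ⊎ Apart g v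
    touches? g v with v ≟F g
    ... | yes v≡g = inj₁ (inj₁ v≡g)
    ... | no v≢g with adj g v in g·v
    ...   | true  = inj₁ (inj₂ refl)
    ...   | false = inj₂ (refl , v≢g ∘ sym)

    data LastTouch (g : Fin n) {h l : Fin n} (w : Walk h l) : Set where
      touching : ∀ {h'} (w' : Walk h' l) → Touches g h' → (∀ v → OnTail w' v → Apart g v) →
                 steps w' ≤ steps w → (∀ v → On w' v → On w v) → LastTouch g w
      untouched : (∀ v → On w v → Apart g v) → LastTouch g w

    last-touch : ∀ g {h l} (w : Walk h l) → LastTouch g w
    last-touch g (stop {h} p) with touches? g h
    ... | inj₁ t = touching (stop p) t (λ _ ()) ≤-refl (λ _ o → o)
    ... | inj₂ a = untouched λ { _ refl → a }
    last-touch g (move {h} p h~ w) with last-touch g w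
    ... | touching w' t avoid ≤w sub = touching w' t avoid (m≤n⇒m≤1+n ≤w) (λ v o → inj₂ (sub v o))
    ... | untouched avoid with touches? g h
    ...   | inj₁ t = touching (move p h~ w) t avoid ≤-refl (λ _ o → o)
    ...   | inj₂ a = untouched λ { _ (inj₁ refl) → a ; v (inj₂ o) → avoid v o }

    record InducedSubpath {g l : Fin n} (w : Walk g l) : Set where
      field
        T       : List (Fin n)
        induced : InducedPath (g ∷ T)
        inside  : All (On w) (g ∷ T)
        reaches : Any (l ≡_) (g ∷ T)

    -- shortcut from the start to the last vertex adjacent to it, and recurse
    -- on the remaining (shorter) walk; f bounds the number of moves
    shortcut : ∀ f {g l} (w : Walk g l) → steps w ≤ f → InducedSubpath w
    shortcut f (stop p) _ = record { T = [] ; induced = tt ; inside = refl ∷ [] ; reaches = here refl }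
    shortcut (suc f) {g} (move {_} {h} p g~h w) (s≤s ≤f) with last-touch g w
    ... | untouched avoid = ⊥-elim (adj⇒≢apart g~h (avoid h (start w)) refl)
      where
      start : ∀ {h l} (w : Walk h l) → On w h
      start (stop _)     = refl
      start (move _ _ _) = inj₁ refl
    ... | touching w' (inj₁ refl) _ ≤w sub =
      record { T = T ; induced = induced ; inside = All.map (inj₂ ∘ sub _) inside ; reaches = reaches }
      where open InducedSubpath (shortcut f w' (≤-trans ≤w ≤f))
    ... | touching {h'} w' (inj₂ g~h') avoid ≤w sub =
      record { T = h' ∷ T
             ; induced = g~h' , (λ g≡h' → no-loop g (subst (λ u → adj g u ≡ true) (sym g≡h') g~h')) ,
                         All.zipWith (λ (o , h'≢v) → avoid _ (later o h'≢v))
                                     (All.tail inside , induced-head-distinct h' T induced) ,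
                         induced
             ; inside = inj₁ refl ∷ All.map (inj₂ ∘ sub _) inside
             ; reaches = there reaches }
      where
      open InducedSubpath (shortcut f w' (≤-trans ≤w ≤f))
      later : ∀ {v} → On w' v → h' ≢ v → OnTail w' v
      later o h'≢v with on-start-or-tail w' o
      ... | inj₁ v≡h' = ⊥-elim (h'≢v (sym v≡h'))
      ... | inj₂ t    = t

    induced-subpath : ∀ {g l} (w : Walk g l) → InducedSubpath w
    induced-subpath w = shortcut (steps w) w ≤-refl

  module Holes (z : Fin n) where

    Hit Miss : Fin n → Set
    Hit  g = adj z g ≡ true
    Miss g = adj z g ≡ false

    data FirstHit : Parity → List (Fin n) → Set where
      hit  : ∀ {g L} → Hit g → FirstHit 0ℙ (g ∷ L)
      miss : ∀ {g L p} → Miss g → FirstHit p L → FirstHit (p ⁻¹) (g ∷ L)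

    firstHit-cons : ∀ g {L} → FirstHit 1ℙ L → FirstHit 0ℙ (g ∷ L)
    firstHit-cons g fh with adj z g in z·g
    ... | true  = hit z·g
    ... | false = miss z·g fh

    firstHit-exists : ∀ {L} → Any Hit L → ∃ λ p → FirstHit p L
    firstHit-exists (here h) = 0ℙ , hit h
    firstHit-exists {g ∷ L} (there a) with adj z g in z·g
    ... | true  = 0ℙ , hit z·g
    ... | false = let (p , fh) = firstHit-exists a in p ⁻¹ , miss z·g fh

    record HitSplit (p : Parity) (L : List (Fin n)) : Set where
      field
        misses  : List (Fin n)
        first   : Fin n
        rest    : List (Fin n)
        split   : L ≡ misses ++ first ∷ rest
        missed  : All Miss misses
        hits    : Hit first
        parity≡ : parity (length misses) ≡ p

    firstHit-split : ∀ {p L} → FirstHit p L → HitSplit p L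
    firstHit-split (hit {g} {L} h) = record
      { misses = [] ; first = g ; rest = L ; split = refl ; missed = [] ; hits = h ; parity≡ = refl }
    firstHit-split (miss {g} m fh) = record
      { misses = g ∷ misses ; first = first ; rest = rest ; split = cong (g ∷_) split
      ; missed = m ∷ missed ; hits = hits ; parity≡ = parity-suc (length misses) parity≡ }
      where
      open HitSplit (firstHit-split fh)
      parity-suc : ∀ m {p} → parity m ≡ p → parity (suc m) ≡ p ⁻¹
      parity-suc m refl = trans (sym (⁻¹-involutive _)) (cong _⁻¹ (suc-homo-⁻¹ m))

    SeesEnds : List (Fin n) → Set
    SeesEnds Q = ∀ (q : Fin (length Q)) → Hit (lookup Q q) ⇔ ((toℕ q ≡ 0) ⊎ (suc (toℕ q) ≡ length Q))

    sees-last : ∀ M h → All Miss M → Hit h →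
      ∀ (q : Fin (length (M ++ h ∷ []))) → Hit (lookup (M ++ h ∷ []) q) ⇔ (suc (toℕ q) ≡ length (M ++ h ∷ []))
    sees-last [] h _ z~h fz = mk⇔ (λ _ → refl) (λ _ → z~h)
    sees-last (g ∷ M) h (z≁g ∷ _) _ fz =
      mk⇔ (⊥-elim ∘ false≢true ∘ trans (sym z≁g)) (⊥-elim ∘ nonempty M ∘ suc-injective)
      where
      nonempty : ∀ M → 0 ≢ length (M ++ h ∷ [])
      nonempty []      ()
      nonempty (_ ∷ _) ()
    sees-last (g ∷ M) h (_ ∷ missed) z~h (fs q) =
      mk⇔ (cong suc ∘ Equivalence.to eqv) (Equivalence.from eqv ∘ suc-injective)
      where eqv = sees-last M h missed z~h q

    cycle : (Q : List (Fin n)) → Fin (suc (length Q)) → Fin n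
    cycle Q fz     = z
    cycle Q (fs q) = lookup Q q

    path+z⇒cycle : ∀ g M → let Q = g ∷ M in
                   InducedPath Q → All (z ≢_) Q → SeesEnds Q → InducedCycle G (suc (length Q))
    path+z⇒cycle g M ip z∉Q sees = cycle Q , injective , adjacency
      where
      Q = g ∷ M
      injective : ∀ p q → cycle Q p ≡ cycle Q q → p ≡ q
      injective fz     fz     _ = refl
      injective fz     (fs q) e = ⊥-elim (All.lookup z∉Q (∈-lookup q) e)
      injective (fs p) fz     e = ⊥-elim (All.lookup z∉Q (∈-lookup p) (sym e))
      injective (fs p) (fs q) e = cong fs (proj₁ (induced-lookup Q ip p q) e)
      adjacency : ∀ p q → (adj (cycle Q p) (cycle Q q) ≡ true) ⇔ CycNb G (suc (length Q)) p q
      adjacency fz fz = mk⇔ (⊥-elim ∘ no-loop z)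
        λ { (inj₁ ()) ; (inj₂ (inj₁ ())) ; (inj₂ (inj₂ (inj₁ (_ , ())))) ; (inj₂ (inj₂ (inj₂ (_ , ())))) }
      adjacency fz (fs q) = mk⇔
        (Sum.[ inj₁ ∘ cong suc , (λ e → inj₂ (inj₂ (inj₁ (refl , cong suc e)))) ]′ ∘ Equivalence.to (sees q))
        λ { (inj₁ e) → Equivalence.from (sees q) (inj₁ (suc-injective e))
          ; (inj₂ (inj₁ ()))
          ; (inj₂ (inj₂ (inj₁ (_ , e)))) → Equivalence.from (sees q) (inj₂ (suc-injective e))
          ; (inj₂ (inj₂ (inj₂ (() , _)))) }
      adjacency (fs p) fz = mk⇔
        (Sum.[ inj₂ ∘ inj₁ ∘ cong suc , (λ e → inj₂ (inj₂ (inj₂ (refl , cong suc e)))) ]′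
           ∘ Equivalence.to (sees p) ∘ trans (adj-sym _ _))
        λ { (inj₁ ())
          ; (inj₂ (inj₁ e)) → trans (adj-sym _ _) (Equivalence.from (sees p) (inj₁ (suc-injective e)))
          ; (inj₂ (inj₂ (inj₁ (() , _))))
          ; (inj₂ (inj₂ (inj₂ (_ , e)))) → trans (adj-sym _ _) (Equivalence.from (sees p) (inj₂ (suc-injective e))) }
      adjacency (fs p) (fs q) = mk⇔
        (Sum.[ inj₁ ∘ cong suc , inj₂ ∘ inj₁ ∘ cong suc ]′ ∘ Equivalence.to eqv)
        λ { (inj₁ e) → Equivalence.from eqv (inj₁ (suc-injective e))
          ; (inj₂ (inj₁ e)) → Equivalence.from eqv (inj₂ (suc-injective e))
          ; (inj₂ (inj₂ (inj₁ (() , _))))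
          ; (inj₂ (inj₂ (inj₂ (() , _)))) }
        where eqv = proj₂ (induced-lookup Q ip p q)

    EvenHole : Set
    EvenHole = ∃ λ m → 4 ≤ m × 2 ∣ m × InducedCycle G m

    -- z, the start g0, an odd number m of missed vertices and the first hit
    -- form a cycle of length 3 + m, which is even and at least four
    odd+3-even : ∀ m → parity m ≡ 1ℙ → 4 ≤ 3 + m × 2 ∣ 3 + m
    odd+3-even zero          ()
    odd+3-even (suc zero)    _   = s≤s (s≤s (s≤s (s≤s z≤n))) , divides 2 refl
    odd+3-even (suc (suc m)) odd with odd+3-even m odd
    ... | _ , divides q e = s≤s (s≤s (s≤s (s≤s z≤n))) , divides (suc q) (cong (suc ∘ suc) e)

    odd-first-hit⇒even-hole : ∀ g0 g1 T → InducedPath (g0 ∷ g1 ∷ T) → Hit g0 → z ≢ g1 →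
                              FirstHit 1ℙ (g1 ∷ T) → EvenHole
    odd-first-hit⇒even-hole g0 g1 T ip z~g0 z≢g1 fh with firstHit-split fh
    ... | record { misses = M ; first = h ; rest = R ; split = split ; missed = missed ; hits = z~h ; parity≡ = odd } =
      3 + length M , proj₁ bounds , proj₂ bounds ,
      subst (InducedCycle G) length-Q (path+z⇒cycle g0 (M ++ h ∷ []) ip-Q z∉Q sees-Q)
      where
      Q = g0 ∷ M ++ h ∷ []
      bounds = odd+3-even (length M) odd
      path≡Q++R : g0 ∷ g1 ∷ T ≡ Q ++ R
      path≡Q++R = cong (g0 ∷_) (trans split (sym (++-assoc M (h ∷ []) R)))
      z∉path : All (z ≢_) (g0 ∷ g1 ∷ T)
      z∉path = (λ z≡g0 → no-loop z (subst (λ u → adj z u ≡ true) (sym z≡g0) z~g0))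
             ∷ z≢g1 ∷ All.map (adj⇒≢apart (trans (adj-sym _ _) z~g0)) (proj₁ (proj₂ (proj₂ ip)))
      ip-Q : InducedPath Q
      ip-Q = induced-prefix Q (subst InducedPath path≡Q++R ip)
      z∉Q : All (z ≢_) Q
      z∉Q = ++⁻ˡ Q (subst (All (z ≢_)) path≡Q++R z∉path)
      sees-Q : SeesEnds Q
      sees-Q fz     = mk⇔ (λ _ → inj₁ refl) (λ _ → z~g0)
      sees-Q (fs q) = mk⇔ (inj₂ ∘ cong suc ∘ Equivalence.to (last q))
                          λ { (inj₁ ()) ; (inj₂ e) → Equivalence.from (last q) (suc-injective e) }
        where last = sees-last M h missed z~h
      length-Q : suc (length Q) ≡ 3 + length M
      length-Q = cong (suc ∘ suc) (trans (length-++ M) (+-comm (length M) 1))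

module Connectivity {nv m : ℕ} (u v : Fin m → Fin nv) where
  open EdgeSys u v

  Conn-trans : ∀ {F x y z} → Conn F x y → Conn F y z → Conn F x z
  Conn-trans here         c' = c'
  Conn-trans (fwd e f c) c' = fwd e f (Conn-trans c c')
  Conn-trans (bwd e f c) c' = bwd e f (Conn-trans c c')

  Conn-sym : ∀ {F x y} → Conn F x y → Conn F y x
  Conn-sym here         = here
  Conn-sym (fwd e f c) = Conn-trans (Conn-sym c) (bwd e f here)
  Conn-sym (bwd e f c) = Conn-trans (Conn-sym c) (fwd e f here)

module RedArborescence {k : ℕ} (σ : Setting k) where
  open Setting σ using (r; bitree)
  open BiTree k (Setting.a σ) (Setting.b σ) r using (DReach; root; step; module R)
  open Connectivity {suc k} {k} inject₁ r using (Conn-sym)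

  avoid-arc : ∀ {S} t {x} → DReach S (inject₁ t) x →
              R.Conn (λ e → R.Inside (λ _ → ⊤) e × e ≢ t) x (inject₁ t)
  avoid-arc t root = R.here
  avoid-arc t (step t' _ _ d) with inject₁ t' ≟F inject₁ t
  ... | yes t'≡t = subst (λ x → R.Conn _ x (inject₁ t)) (sym t'≡t) R.here
  ... | no t'≢t  = R.fwd t' ((tt , tt) , t'≢t ∘ cong inject₁) (avoid-arc t d)

  -- no directed red path returns from the head of an arc to its tail,
  -- since every red arc is a bridge of the red tree
  red-acyclic : ∀ {S} t → DReach S (inject₁ t) (r t) → ⊥
  red-acyclic t d = proj₂ (proj₁ (proj₂ (proj₂ bitree))) t (tt , tt) (Conn-sym (avoid-arc t d))

-- A separation (i, B, C) of the bi-tree of a setting, with the root k+1 in C.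
-- A vertex u is in B when side u ≡ sX and in C when side u ≡ sY.
module Separation {k : ℕ} (σ : Setting k) (i : Fin (suc k))
  (side : Fin (suc k) → BiTree.Side k (Setting.a σ) (Setting.b σ) (Setting.r σ))
  (sep : BiTree.IsSeparation k (Setting.a σ) (Setting.b σ) (Setting.r σ) i side)
  (root∈C : side (fromℕ k) ≡ BiTree.sY)
  where
  open Setting σ using (a; b; r; a≢b; r≢; bitree)
  open BiTree k a b r using (Side; sv; sX; sY; DReach; root; step; module W; module R)
  open RedArborescence σ using (red-acyclic)

  V : Set
  V = Fin (suc k)

  InB InC : V → Set
  InB u = side u ≡ sX
  InC u = side u ≡ sY

  side-i : side i ≡ sv
  side-i = Equivalence.from (proj₁ sep i) refl

  side-sv : ∀ {u} → side u ≡ sv → u ≡ i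
  side-sv {u} = Equivalence.to (proj₁ sep u)

  B⇒¬C : ∀ {u} → InB u → ¬ InC u
  B⇒¬C {u} u∈B u∈C with trans (sym u∈B) u∈C
  ... | ()

  i∉B : ¬ InB i
  i∉B i∈B with trans (sym side-i) i∈B
  ... | ()

  i∉C : ¬ InC i
  i∉C i∈C with trans (sym side-i) i∈C
  ... | ()

  B≢C : ∀ {u u'} → InB u → InC u' → u ≢ u'
  B≢C u∈B u'∈C refl = B⇒¬C u∈B u'∈C

  C≢i : ∀ {u} → InC u → u ≢ i
  C≢i u∈C refl = i∉C u∈C

  B≢i : ∀ {u} → InB u → u ≢ i
  B≢i u∈B refl = i∉B u∈B

  ¬C⇒B⊎i : ∀ {u} → ¬ InC u → InB u ⊎ u ≡ i
  ¬C⇒B⊎i {u} u∉C with side u in eq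
  ... | sX = inj₁ refl
  ... | sY = ⊥-elim (u∉C refl)
  ... | sv = inj₂ (side-sv eq)

  white-BC : ∀ e → InB (a e) → ¬ InC (b e)
  white-BC e a∈B b∈C = proj₁ (proj₂ (proj₂ (proj₂ sep))) e (a∈B , b∈C)
  white-CB : ∀ e → InC (a e) → ¬ InB (b e)
  white-CB e a∈C b∈B = proj₁ (proj₂ (proj₂ (proj₂ (proj₂ sep)))) e (a∈C , b∈B)
  red-BC : ∀ t → InB (inject₁ t) → ¬ InC (r t)
  red-BC t t∈B rt∈C = proj₁ (proj₂ (proj₂ (proj₂ (proj₂ (proj₂ sep))))) t (t∈B , rt∈C)
  red-CB : ∀ t → InC (inject₁ t) → ¬ InB (r t)
  red-CB t t∈C rt∈B = proj₂ (proj₂ (proj₂ (proj₂ (proj₂ (proj₂ sep))))) t (t∈C , rt∈B)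

  -- i is not the root, so it is the tail i' of a red arc
  i' : Fin k
  i' = lower₁ i (C≢i root∈C ∘ toℕ-injective ∘ trans (toℕ-fromℕ k))

  i'↑ : inject₁ i' ≡ i
  i'↑ = inject₁-lower₁ i _

  data RedChain : V → Set where
    at-i : RedChain i
    via  : ∀ t → InB (inject₁ t) → RedChain (r t) → RedChain (inject₁ t)

  red-chain : ∀ {S v} → DReach S (fromℕ k) v → ¬ InC v → RedChain v
  red-chain root v∉C = ⊥-elim (v∉C root∈C)
  red-chain (step t _ _ d) t∉C with ¬C⇒B⊎i t∉C
  ... | inj₂ t≡i = subst RedChain (sym t≡i) at-i
  ... | inj₁ t∈B = via t t∈B (red-chain d (red-BC t t∈B))

  red-chain-from : ∀ v → ¬ InC v → RedChain v
  red-chain-from v = red-chain (proj₂ (proj₂ (proj₂ bitree)) v tt)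

  OnChain : ∀ {v} → RedChain v → V → Set
  OnChain at-i        u = u ≡ i
  OnChain (via t _ c) u = (u ≡ inject₁ t) ⊎ OnChain c u

  chain-start : ∀ {v} (c : RedChain v) → OnChain c v
  chain-start at-i        = refl
  chain-start (via t _ c) = inj₁ refl

  chain-reaches : ∀ {v u} (c : RedChain v) → OnChain c u → DReach (λ _ → ⊤) u v
  chain-reaches at-i        refl        = root
  chain-reaches (via t _ c) (inj₁ refl) = root
  chain-reaches (via t _ c) (inj₂ o)    = step t tt tt (chain-reaches c o)

  Simple : ∀ {v} → RedChain v → Set
  Simple at-i        = ⊤
  Simple (via t _ c) = ¬ OnChain c (inject₁ t) × Simple c

  chain-simple : ∀ {v} (c : RedChain v) → Simple c
  chain-simple at-i        = tt
  chain-simple (via t _ c) = (λ o → red-acyclic t (chain-reaches c o)) , chain-simple c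

  -- the red out-neighbour of i lies in C: it is not i, and were it in B
  -- its red chain back to i would close a directed cycle
  r-i∈C : InC (r i')
  r-i∈C with side (r i') in eq
  ... | sY = refl
  ... | sv = ⊥-elim (r≢ i' (trans (side-sv eq) (sym i'↑)))
  ... | sX = ⊥-elim (red-acyclic i' (subst (λ u → DReach _ u (r i')) (sym i'↑)
                      (chain-path (red-chain-from (r i') (B⇒¬C eq)))))
    where
    chain-path : ∀ {v} → RedChain v → DReach (λ _ → ⊤) i v
    chain-path c = chain-reaches c (last c)
      where
      last : ∀ {v} (c : RedChain v) → OnChain c i
      last at-i        = refl
      last (via t _ c) = inj₂ (last c)

  -- If i is a leaf of the bi-tree T \ B in one colour (an edge system u, v
  -- without B–C edges), then any connection between two vertices of C can
  -- be rerouted inside C: a detour through i leaves and re-enters C through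
  -- the unique neighbour of i in C, and B is reachable only through i.
  module LeafRestriction {m : ℕ} (u v : Fin m → V) (u≢v : ∀ e → u e ≢ v e)
    (BC : ∀ e → InB (u e) → ¬ InC (v e)) (CB : ∀ e → InC (u e) → ¬ InB (v e))
    (leaf : EdgeSys.IsLeafOn u v (λ x → side x ≢ sX) i) where
    open EdgeSys u v

    e0 : Fin m
    e0 = proj₁ (proj₂ leaf)
    i∈e0 : Incident i e0
    i∈e0 = proj₁ (proj₂ (proj₂ (proj₂ leaf)))
    unique : ∀ e → Inside (λ x → side x ≢ sX) e → Incident i e → e ≡ e0
    unique = proj₂ (proj₂ (proj₂ (proj₂ leaf)))

    c0 : V
    c0 with i∈e0
    ... | inj₁ _ = v e0
    ... | inj₂ _ = u e0

    C⇒¬B : ∀ {x} → InC x → ¬ InB x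
    C⇒¬B x∈C x∈B = B⇒¬C x∈B x∈C

    from-i-at-u : ∀ e → InC (v e) → u e ≡ i → v e ≡ c0
    from-i-at-u e v∈C u≡i with unique e (subst (λ x → ¬ InB x) (sym u≡i) i∉B , C⇒¬B v∈C) (inj₁ u≡i)
    ... | refl with i∈e0
    ...   | inj₁ _   = refl
    ...   | inj₂ v≡i = ⊥-elim (C≢i v∈C v≡i)

    from-i-at-v : ∀ e → InC (u e) → v e ≡ i → u e ≡ c0
    from-i-at-v e u∈C v≡i with unique e (C⇒¬B u∈C , subst (λ x → ¬ InB x) (sym v≡i) i∉B) (inj₂ v≡i)
    ... | refl with i∈e0
    ...   | inj₁ u≡i = ⊥-elim (C≢i u∈C u≡i)
    ...   | inj₂ _   = refl

    ConnC : V → V → Set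
    ConnC = Conn (Inside InC)

    mutual
      reroute-C : ∀ {F x y} → Conn F x y → InC x → InC y → ConnC x y
      reroute-C here _ _ = here
      reroute-C (fwd e _ c) u∈C y∈C with side (v e) in v-side
      ... | sY = fwd e (u∈C , v-side) (reroute-C c v-side y∈C)
      ... | sX = ⊥-elim (CB e u∈C v-side)
      ... | sv = subst (λ x → ConnC x _) (sym (from-i-at-v e u∈C (side-sv v-side))) (reroute-i c (side-sv v-side) y∈C)
      reroute-C (bwd e _ c) v∈C y∈C with side (u e) in u-side
      ... | sY = bwd e (u-side , v∈C) (reroute-C c u-side y∈C)
      ... | sX = ⊥-elim (BC e u-side v∈C)
      ... | sv = subst (λ x → ConnC x _) (sym (from-i-at-u e v∈C (side-sv u-side))) (reroute-i c (side-sv u-side) y∈C)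

      reroute-i : ∀ {F x y} → Conn F x y → x ≡ i → InC y → ConnC c0 y
      reroute-i here refl y∈C = ⊥-elim (i∉C y∈C)
      reroute-i (fwd e _ c) u≡i y∈C with side (v e) in v-side
      ... | sY = subst (λ x → ConnC x _) (from-i-at-u e v-side u≡i) (reroute-C c v-side y∈C)
      ... | sX = reroute-B c v-side y∈C
      ... | sv = ⊥-elim (u≢v e (trans u≡i (sym (side-sv v-side))))
      reroute-i (bwd e _ c) v≡i y∈C with side (u e) in u-side
      ... | sY = subst (λ x → ConnC x _) (from-i-at-v e u-side v≡i) (reroute-C c u-side y∈C)
      ... | sX = reroute-B c u-side y∈C
      ... | sv = ⊥-elim (u≢v e (trans (side-sv u-side) (sym v≡i)))

      reroute-B : ∀ {F x y} → Conn F x y → InB x → InC y → ConnC c0 y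
      reroute-B here x∈B y∈C = ⊥-elim (B⇒¬C x∈B y∈C)
      reroute-B (fwd e _ c) u∈B y∈C with side (v e) in v-side
      ... | sY = ⊥-elim (BC e u∈B v-side)
      ... | sX = reroute-B c v-side y∈C
      ... | sv = reroute-i c (side-sv v-side) y∈C
      reroute-B (bwd e _ c) v∈B y∈C with side (u e) in u-side
      ... | sY = ⊥-elim (CB e u-side v∈B)
      ... | sX = reroute-B c u-side y∈C
      ... | sv = reroute-i c (side-sv u-side) y∈C

  ConnectedInC : V → V → Set
  ConnectedInC x y = R.Conn (R.Inside InC) x y ⊎ W.Conn (W.Inside InC) x y

  C-connected : EdgeSys.IsLeafOn {suc k} {k} inject₁ r (λ x → side x ≢ sX) i
                ⊎ EdgeSys.IsLeafOn a b (λ x → side x ≢ sX) i →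
                ∀ {x y} → InC x → InC y → ConnectedInC x y
  C-connected (inj₁ red-leaf) {x} {y} x∈C y∈C =
    inj₁ (Red.reroute-C (proj₁ (proj₁ (proj₂ (proj₂ bitree))) x y tt tt) x∈C y∈C)
    where module Red = LeafRestriction inject₁ r (λ t → r≢ t ∘ sym) red-BC red-CB red-leaf
  C-connected (inj₂ white-leaf) {x} {y} x∈C y∈C =
    inj₂ (White.reroute-C (proj₁ (proj₁ (proj₂ bitree)) x y tt tt) x∈C y∈C)
    where module White = LeafRestriction a b a≢b white-BC white-CB white-leaf

  WhiteEdge : Fin k → V → V → Set
  WhiteEdge e p q = (a e ≡ p × b e ≡ q) ⊎ (a e ≡ q × b e ≡ p)

  white-ends : ∀ {e p q} → WhiteEdge e p q → ((p ≡ a e) ⊎ (p ≡ b e)) × ((q ≡ a e) ⊎ (q ≡ b e))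
  white-ends (inj₁ (refl , refl)) = inj₁ refl , inj₂ refl
  white-ends (inj₂ (refl , refl)) = inj₂ refl , inj₁ refl

  white-other : ∀ {e p q u} → WhiteEdge e p q → u ≢ p → u ≢ q → (u ≢ a e) × (u ≢ b e)
  white-other (inj₁ (refl , refl)) u≢p u≢q = u≢p , u≢q
  white-other (inj₂ (refl , refl)) u≢p u≢q = u≢q , u≢p

  white-outside-C : ∀ {e p q} → WhiteEdge e p q → ¬ InC p → ¬ InC q → ¬ InC (a e) × ¬ InC (b e)
  white-outside-C (inj₁ (refl , refl)) p∉C q∉C = p∉C , q∉C
  white-outside-C (inj₂ (refl , refl)) p∉C q∉C = q∉C , p∉C

  white-determined : ∀ {e p q q'} → WhiteEdge e p q → WhiteEdge e p q' → p ≢ q → q ≡ q'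
  white-determined (inj₁ (refl , refl)) (inj₁ (_ , refl)) _   = refl
  white-determined (inj₁ (refl , refl)) (inj₂ (_ , b≡p)) p≢q = ⊥-elim (p≢q (sym b≡p))
  white-determined (inj₂ (refl , refl)) (inj₁ (a≡p , _)) p≢q = ⊥-elim (p≢q (sym a≡p))
  white-determined (inj₂ (refl , refl)) (inj₂ (a≡q' , _)) _ = a≡q'

  data WhiteAccess (j : V) : Set where
    direct   : ∀ e → WhiteEdge e j i → WhiteAccess j
    two-step : ∀ e1 e2 v1 → InB v1 → v1 ≢ j → WhiteEdge e1 v1 j → WhiteEdge e2 v1 i → WhiteAccess j

  open BiTree k a b r using (PathData; Rng; HasWhite; IsBiPathWithRoot; IsBiSpiderOn)

  -- in a bi-path v_1 … v_m with root v_m = i, every v_p ≠ i is white-adjacent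
  -- to i (p = 1 or p > t) or white-adjacent to v_1, itself white-adjacent to i
  bi-path-access : ∀ P → IsBiPathWithRoot P i → (∀ x → Rng P x → ¬ InC x) →
                   ∀ {j} → Rng P j → j ≢ i → WhiteAccess j
  bi-path-access P (2≤m , _ , _ , injective , last↦ , _ , _ , _ , first-last , first-early , late-last)
                 outside-C {j} (pj , pj↦j) j≢i = access (toℕ pj ≟ 0)
    where
    open PathData P
    first = proj₁ (first-position 2≤m)
    last  = proj₁ (last-position 2≤m)
    first↦ = proj₂ (first-position 2≤m)
    last↦i = last↦ last (proj₂ (last-position 2≤m))
    first-i : HasWhite (ord first) i
    first-i = subst (HasWhite (ord first)) last↦i
                (first-last first last first↦ (proj₂ (last-position 2≤m)))
    first≢i : ord first ≢ i
    first≢i e = first≢last 2≤m (cong toℕ (injective first last (trans e (sym last↦i))))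
    first∈B : InB (ord first)
    first∈B with ¬C⇒B⊎i (outside-C (ord first) (first , refl))
    ... | inj₁ ∈B = ∈B
    ... | inj₂ ≡i = ⊥-elim (first≢i ≡i)
    access : Dec (toℕ pj ≡ 0) → WhiteAccess j
    access (yes pj≡0) = direct (proj₁ j-i) (proj₂ j-i)
      where
      j-i = subst₂ HasWhite (trans (sym (cong ord (toℕ-injective (trans pj≡0 (sym first↦))))) pj↦j) refl first-i
    access (no pj≢0) with suc (toℕ pj) ≤? t
    ... | yes early =
      two-step (proj₁ first-j) (proj₁ first-i) (ord first) first∈B first≢j (proj₂ first-j) (proj₂ first-i)
      where
      first-j = subst (HasWhite (ord first)) pj↦j (first-early first pj first↦ (n≢0⇒n>0 pj≢0) early)
      first≢j : ord first ≢ j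
      first≢j e = pj≢0 (trans (cong toℕ (injective pj first (trans pj↦j (sym e)))) first↦)
    ... | no late = direct (proj₁ j-i) (proj₂ j-i)
      where
      not-last : suc (suc (toℕ pj)) ≤ m
      not-last = ≤∧≢⇒< (toℕ<n pj) (λ pj-last → j≢i (trans (sym pj↦j) (last↦ pj pj-last)))
      j-i = subst₂ HasWhite pj↦j last↦i
              (late-last pj last (proj₂ (last-position 2≤m)) (≤-pred (≰⇒> late)) not-last)

  -- the root of a bi-spider on T \ C is i: every leg reaches its root by a
  -- directed red path inside T \ C, but the red arc leaving i enters C
  spider-root : ∀ {S ρ x} → (∀ x → S x → ¬ InC x) → DReach S ρ x → x ≡ i → ρ ≡ i
  spider-root _         root              x≡i = x≡i
  spider-root outside-C (step t _ rt∈S _) t≡i =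
    ⊥-elim (outside-C _ rt∈S (subst (InC ∘ r) (inject₁-injective (trans i'↑ (sym t≡i))) r-i∈C))

  spider-access : IsBiSpiderOn (λ x → side x ≢ sY) → ∀ {j} → InB j → j ≢ i → WhiteAccess j
  spider-access (ρ , _ , P , bi-paths , spans , _) {j} j∈B j≢i =
    bi-path-access (P l') (subst (IsBiPathWithRoot (P l')) ρ≡i (bi-paths l')) (outside l') j∈Pl' j≢i
    where
    outside : ∀ l x → Rng (P l) x → ¬ InC x
    outside l x x∈Pl = Equivalence.from (spans x) (l , x∈Pl)
    reach : ∀ l {x} → Rng (P l) x → DReach (Rng (P l)) ρ x
    reach l {x} = let (_ , _ , _ , _ , _ , (_ , _ , _ , reaches) , _) = bi-paths l in reaches x
    l = proj₁ (Equivalence.to (spans i) i∉C)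
    ρ≡i = spider-root (outside l) (reach l (proj₂ (Equivalence.to (spans i) i∉C))) refl
    l' = proj₁ (Equivalence.to (spans j) (B⇒¬C j∈B))
    j∈Pl' = proj₂ (Equivalence.to (spans j) (B⇒¬C j∈B))

  module InGraph (Y : YSet σ) where
    open Setting σ using (G; n; adj; loc; w; w-loc; clique; W-indep; w-adj; x; x-loc; x-indep; x-red; x-non)
      renaming (sym to adj-sym)
    open YSet Y using (y; y-loc; y-indep; y≢x)
    open GraphFacts G using (Apart; Apart-sym)

    loc-w : ∀ e → loc (w e) ≡ inj₂ e
    loc-w e = Equivalence.from (w-loc (w e) e) refl

    parts-≢ : ∀ {g h p q} → loc g ≡ inj₁ p → loc h ≡ inj₁ q → p ≢ q → g ≢ h
    parts-≢ g∈p h∈q p≢q refl = p≢q (inj₁-injective (trans (sym g∈p) h∈q))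

    part-≢-w : ∀ {g p e} → loc g ≡ inj₁ p → g ≢ w e
    part-≢-w {e = e} g∈p refl with trans (sym g∈p) (loc-w e)
    ... | ()

    w-injective : ∀ {e f} → w e ≡ w f → e ≡ f
    w-injective {e} {f} we≡wf =
      inj₂-injective (trans (sym (loc-w e)) (subst (λ g → loc g ≡ inj₂ f) (sym we≡wf) (loc-w f)))

    y-x-own : ∀ t → adj (y (inject₁ t)) (x t) ≡ true
    y-x-own t = clique (inject₁ t) _ _ (y-loc _) (x-loc t) (y≢x t)

    x-y-red : ∀ t → adj (x t) (y (r t)) ≡ true
    x-y-red t = x-red t (y (r t)) (y-loc (r t)) (λ u u↑≡rt → y≢x u ∘ trans (cong y u↑≡rt))

    x-y-apart : ∀ t p → p ≢ inject₁ t → p ≢ r t → Apart (x t) (y p)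
    x-y-apart t p p≢t p≢rt = x-non t p (y p) (y-loc p) p≢t p≢rt , parts-≢ (x-loc t) (y-loc p) (p≢t ∘ sym)

    y-y-apart : ∀ p q → p ≢ q → Apart (y p) (y q)
    y-y-apart p q p≢q = y-indep p q , parts-≢ (y-loc p) (y-loc q) p≢q

    x-x-apart : ∀ t u → inject₁ t ≢ inject₁ u → Apart (x t) (x u)
    x-x-apart t u t≢u = x-indep t u , parts-≢ (x-loc t) (x-loc u) t≢u

    w-w-apart : ∀ e f → e ≢ f → Apart (w e) (w f)
    w-w-apart e f e≢f = W-indep e f , e≢f ∘ w-injective

    w-sees : ∀ e g p → loc g ≡ inj₁ p → (p ≡ a e) ⊎ (p ≡ b e) → adj (w e) g ≡ true
    w-sees e g p g∈p = Equivalence.from (w-adj e p g g∈p)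

    w-apart : ∀ e g p → loc g ≡ inj₁ p → p ≢ a e → p ≢ b e → Apart (w e) g
    w-apart e g p g∈p p≢a p≢b =
      ≢true⇒false (Sum.[ p≢a , p≢b ]′ ∘ Equivalence.to (w-adj e p g g∈p)) , part-≢-w g∈p ∘ sym

    y-w-adj : ∀ e p → (p ≡ a e) ⊎ (p ≡ b e) → adj (y p) (w e) ≡ true
    y-w-adj e p p∈e = trans (adj-sym _ _) (w-sees e (y p) p (y-loc p) p∈e)

    data CRegion : Fin n → Set where
      y∈ : ∀ {c} → InC c → CRegion (y c)
      x∈ : ∀ {t} → InC (inject₁ t) → InC (r t) → CRegion (x t)
      w∈ : ∀ {e} → InC (a e) → InC (b e) → CRegion (w e)

    data BRegion : Fin n → Set where
      y∈ : ∀ {q} → ¬ InC q → BRegion (y q)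
      x∈ : ∀ {t} → InB (inject₁ t) → BRegion (x t)
      w∈ : ∀ {e} → ¬ InC (a e) → ¬ InC (b e) → BRegion (w e)

    C≢¬C : ∀ {u v} → InC u → ¬ InC v → u ≢ v
    C≢¬C u∈C v∉C refl = v∉C u∈C

    ¬C≢C : ∀ {u v} → ¬ InC u → InC v → u ≢ v
    ¬C≢C u∉C v∈C refl = u∉C v∈C

    -- no edge of G joins the two regions (the separation has no B–C edges)
    C-apart-B : ∀ {g h} → CRegion g → BRegion h → Apart g h
    C-apart-B (y∈ {c} c∈C) (y∈ {q} q∉C) = y-y-apart c q (C≢¬C c∈C q∉C)
    C-apart-B (y∈ {c} c∈C) (x∈ {t} t∈B) =
      Apart-sym (x-y-apart t c (C≢¬C c∈C (B⇒¬C t∈B)) (C≢¬C c∈C (red-BC t t∈B)))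
    C-apart-B (y∈ {c} c∈C) (w∈ {e} a∉C b∉C) =
      Apart-sym (w-apart e (y c) c (y-loc c) (C≢¬C c∈C a∉C) (C≢¬C c∈C b∉C))
    C-apart-B (x∈ {t} t∈C rt∈C) (y∈ {q} q∉C) = x-y-apart t q (¬C≢C q∉C t∈C) (¬C≢C q∉C rt∈C)
    C-apart-B (x∈ {t} t∈C _) (x∈ {u} u∈B) = x-x-apart t u (C≢¬C t∈C (B⇒¬C u∈B))
    C-apart-B (x∈ {t} t∈C _) (w∈ {e} a∉C b∉C) =
      Apart-sym (w-apart e (x t) (inject₁ t) (x-loc t) (C≢¬C t∈C a∉C) (C≢¬C t∈C b∉C))
    C-apart-B (w∈ {e} a∈C b∈C) (y∈ {q} q∉C) = w-apart e (y q) q (y-loc q) (¬C≢C q∉C a∈C) (¬C≢C q∉C b∈C)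
    C-apart-B (w∈ {e} a∈C b∈C) (x∈ {t} t∈B) =
      w-apart e (x t) (inject₁ t) (x-loc t) (¬C≢C (B⇒¬C t∈B) a∈C) (¬C≢C (B⇒¬C t∈B) b∈C)
    C-apart-B (w∈ {e} a∈C _) (w∈ {f} a'∉C _) = w-w-apart e f (λ { refl → a'∉C a∈C })

    i'∉C : ¬ InC (inject₁ i')
    i'∉C = i∉C ∘ subst InC i'↑


    x-i-apart-C : ∀ {g} → CRegion g → g ≢ y (r i') → Apart (x i') g
    x-i-apart-C (y∈ {c} c∈C) g≢y-ri = x-y-apart i' c (C≢¬C c∈C i'∉C) (g≢y-ri ∘ cong y)
    x-i-apart-C (x∈ {t} t∈C _) _ = x-x-apart i' t (¬C≢C i'∉C t∈C)
    x-i-apart-C (w∈ {e} a∈C b∈C) _ =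
      Apart-sym (w-apart e (x i') (inject₁ i') (x-loc i') (¬C≢C i'∉C a∈C) (¬C≢C i'∉C b∈C))

    open GraphFacts.Walks G CRegion using (Walk; stop; move)

    -- a connection inside C lifts to a walk of G inside the C-region,
    -- through y_t x_t y_{r(t)} for a red arc and y_a w_e y_b for a white edge
    red-walk : ∀ {c c'} → R.Conn (R.Inside InC) c c' → InC c → Walk (y c) (y c')
    red-walk R.here c∈C = stop (y∈ c∈C)
    red-walk (R.fwd t (t∈C , rt∈C) conn) _ =
      move (y∈ t∈C) (y-x-own t) (move (x∈ t∈C rt∈C) (x-y-red t) (red-walk conn rt∈C))
    red-walk (R.bwd t (t∈C , rt∈C) conn) _ =
      move (y∈ rt∈C) (trans (adj-sym _ _) (x-y-red t))
        (move (x∈ t∈C rt∈C) (trans (adj-sym _ _) (y-x-own t)) (red-walk conn t∈C))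

    white-walk : ∀ {c c'} → W.Conn (W.Inside InC) c c' → InC c → Walk (y c) (y c')
    white-walk W.here c∈C = stop (y∈ c∈C)
    white-walk (W.fwd e (a∈C , b∈C) conn) _ =
      move (y∈ a∈C) (y-w-adj e (a e) (inj₁ refl))
        (move (w∈ a∈C b∈C) (w-sees e (y (b e)) (b e) (y-loc (b e)) (inj₂ refl)) (white-walk conn b∈C))
    white-walk (W.bwd e (a∈C , b∈C) conn) _ =
      move (y∈ b∈C) (y-w-adj e (b e) (inj₂ refl))
        (move (w∈ a∈C b∈C) (w-sees e (y (a e)) (a e) (y-loc (a e)) (inj₁ refl)) (white-walk conn a∈C))

    C-walk : ∀ {c c'} → ConnectedInC c c' → InC c → Walk (y c) (y c')
    C-walk (inj₁ red)   = red-walk red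
    C-walk (inj₂ white) = white-walk white

    module Contradiction (ehf : EvenHoleFree G)
      (leaf : EdgeSys.IsLeafOn {suc k} {k} inject₁ r (λ u → side u ≢ sX) i
              ⊎ EdgeSys.IsLeafOn a b (λ u → side u ≢ sX) i)
      (j : V) (j∈B : InB j) (j≢i : j ≢ i) (s : V) (s∈C : InC s)
      (z : Fin n) (z∈s : loc z ≡ inj₁ s) (yj~z : adj (y j) z ≡ true)
      where
      open GraphFacts G using (InducedPath; induced-head-distinct; module Walks)
      open Walks CRegion using (InducedSubpath; induced-subpath; on-walk-inside)
      open GraphFacts.Holes G z using (Hit; Miss; FirstHit; hit; miss; firstHit-cons; firstHit-exists;
                                       odd-first-hit⇒even-hole)

      module Base = InducedSubpath (induced-subpath (C-walk (C-connected leaf r-i∈C s∈C) r-i∈C))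
      open Base using () renaming (T to T₀)

      L₀ : List (Fin n)
      L₀ = x i' ∷ y (r i') ∷ T₀

      C-path : All CRegion (y (r i') ∷ T₀)
      C-path = All.map (on-walk-inside _) Base.inside

      L₀-induced : InducedPath L₀
      L₀-induced = x-y-red i' , parts-≢ (x-loc i') (y-loc (r i')) (r≢ i' ∘ sym) ,
                   All.zipWith (λ (g∈C , g≢y) → x-i-apart-C g∈C (g≢y ∘ sym))
                     (All.tail C-path , induced-head-distinct (y (r i')) T₀ Base.induced) ,
                   Base.induced

      B-apart-C-path : ∀ {g} → BRegion g → All (Apart g) (y (r i') ∷ T₀)
      B-apart-C-path g∈B = All.map (λ h∈C → Apart-sym (C-apart-B h∈C g∈B)) C-path

      y-apart-L₀ : ∀ {q} → InB q → All (Apart (y q)) L₀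
      y-apart-L₀ {q} q∈B =
        Apart-sym (x-y-apart i' q (B≢i q∈B ∘ (λ q≡i' → trans q≡i' i'↑)) (B≢C q∈B r-i∈C))
                         ∷ B-apart-C-path (y∈ (B⇒¬C q∈B))

      -- z sees the end y_s of the base path (same part, and z ≠ y_s as y_j
      -- sees z but not y_s), so some vertex of L₀ is a first hit
      z-sees-ys : Hit (y s)
      z-sees-ys = clique s z (y s) z∈s (y-loc s) z≢ys
        where
        z≢ys : z ≢ y s
        z≢ys refl with trans (sym (y-indep j s)) yj~z
        ... | ()

      first-hit-L₀ : ∃ λ p → FirstHit p L₀
      first-hit-L₀ = firstHit-exists (there (Any.map (λ { refl → z-sees-ys }) Base.reaches))

      x-miss : ∀ {t} → InB (inject₁ t) → Miss (x t)
      x-miss {t} t∈B = trans (adj-sym _ _) (x-non t s z z∈s (C≢¬C s∈C (B⇒¬C t∈B)) (C≢¬C s∈C (red-BC t t∈B)))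

      w-miss : ∀ {e} → ¬ InC (a e) → ¬ InC (b e) → Miss (w e)
      w-miss {e} a∉C b∉C = proj₁ (Apart-sym (w-apart e z s z∈s (C≢¬C s∈C a∉C) (C≢¬C s∈C b∉C)))

      z-hits-yj : Hit (y j)
      z-hits-yj = trans (adj-sym _ _) yj~z

      no-odd-hit-from-yj : ∀ g1 T → InducedPath (y j ∷ g1 ∷ T) → z ≢ g1 → FirstHit 1ℙ (g1 ∷ T) → ⊥
      no-odd-hit-from-yj g1 T ip z≢g1 fh =
        let (m , 4≤m , 2∣m , hole) = odd-first-hit⇒even-hole (y j) g1 T ip z-hits-yj z≢g1 fh in ehf m 4≤m 2∣m hole

      -- Odd first hit on L₀: follow the red chain from j to i.  For a chain
      -- v = t₁ → t₂ → … → i the path y_{t₁}, x_{t₁}, y_{t₂}, …, y_i, L₀ is induced.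
      chain-path : ∀ {v} → RedChain v → List (Fin n)
      chain-path at-i        = y i ∷ L₀
      chain-path (via t _ c) = y (inject₁ t) ∷ x t ∷ chain-path c

      x-i-apart-B : ∀ {t} → InB (inject₁ t) → Apart (x t) (x i')
      x-i-apart-B t∈B = x-x-apart _ i' (B≢i t∈B ∘ (λ t≡i' → trans t≡i' i'↑))

      y-apart-chain : ∀ {v q} (c : RedChain v) → InB q → ¬ OnChain c q → All (Apart (y q)) (chain-path c)
      y-apart-chain at-i q∈B q∉c = y-y-apart _ i q∉c ∷ y-apart-L₀ q∈B
      y-apart-chain (via t _ c) q∈B q∉c =
        y-y-apart _ (inject₁ t) (q∉c ∘ inj₁) ∷
        Apart-sym (x-y-apart t _ (q∉c ∘ inj₁) (λ q≡rt → q∉c (inj₂ (subst (OnChain c) (sym q≡rt) (chain-start c))))) ∷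
        y-apart-chain c q∈B (q∉c ∘ inj₂)

      x-apart-chain : ∀ {v t} (c : RedChain v) → InB (inject₁ t) →
                      ¬ OnChain c (inject₁ t) → ¬ OnChain c (r t) → All (Apart (x t)) (chain-path c)
      x-apart-chain at-i t∈B t∉c rt∉c =
        x-y-apart _ i (t∉c ∘ sym) (rt∉c ∘ sym) ∷ x-i-apart-B t∈B ∷ B-apart-C-path (x∈ t∈B)
      x-apart-chain (via t' _ c) t∈B t∉c rt∉c =
        x-y-apart _ (inject₁ t') (t∉c ∘ inj₁ ∘ sym) (rt∉c ∘ inj₁ ∘ sym) ∷
        x-x-apart _ t' (t∉c ∘ inj₁) ∷
        x-apart-chain c t∈B (t∉c ∘ inj₂) (rt∉c ∘ inj₂)

      x-then-chain : ∀ {t v} → InB (inject₁ t) → r t ≡ v → (c : RedChain v) → ¬ OnChain c (inject₁ t) →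
                     Simple c → InducedPath (chain-path c) → InducedPath (x t ∷ chain-path c)
      x-then-chain {t} t∈B rt≡i at-i t∉c _ ip =
        subst (λ u → adj (x t) (y u) ≡ true) rt≡i (x-y-red t) , parts-≢ (x-loc t) (y-loc i) t∉c ,
        x-i-apart-B t∈B ∷ B-apart-C-path (x∈ t∈B) , ip
      x-then-chain {t} t∈B rt≡t' (via t' _ c) t∉c (t'∉c , _) ip =
        subst (λ u → adj (x t) (y u) ≡ true) rt≡t' (x-y-red t) , parts-≢ (x-loc t) (y-loc _) (t∉c ∘ inj₁) ,
        x-x-apart t t' (t∉c ∘ inj₁) ∷ x-apart-chain c t∈B (t∉c ∘ inj₂) (t'∉c ∘ subst (OnChain c) rt≡t') , ip

      chain-induced : ∀ {v} (c : RedChain v) → Simple c → InducedPath (chain-path c)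
      chain-induced at-i _ =
        subst (λ u → adj (y u) (x i') ≡ true) i'↑ (y-x-own i') , (λ yi≡xi → y≢x i' (trans (cong y i'↑) yi≡xi)) ,
        B-apart-C-path (y∈ i∉C) , L₀-induced
      chain-induced (via t t∈B c) (t∉c , simple) =
        y-x-own t , y≢x t , y-apart-chain c t∈B t∉c ,
        x-then-chain t∈B refl c t∉c simple (chain-induced c simple)

      chain-first-hit : FirstHit 1ℙ L₀ → ∀ {v} (c : RedChain v) → FirstHit 0ℙ (chain-path c)
      chain-first-hit fh at-i = firstHit-cons (y i) fh
      chain-first-hit fh (via t t∈B c) =
        firstHit-cons (y (inject₁ t)) (miss (x-miss t∈B) (chain-first-hit fh c))

      red-case : FirstHit 1ℙ L₀ → ∀ {v} → v ≡ j → (c : RedChain v) → Simple c → ⊥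
      red-case _  v≡j at-i _ = j≢i (sym v≡j)
      red-case fh refl (via t t∈B c) simple =
        no-odd-hit-from-yj (x t) (chain-path c) (chain-induced (via t t∈B c) simple)
          (parts-≢ z∈s (x-loc t) (C≢¬C s∈C (B⇒¬C t∈B))) (miss (x-miss t∈B) (chain-first-hit fh c))

      -- Even first hit on L₀: reach i by white edges of T \ C instead.
      -- For a white edge e from u ∉ C to i, the path w_e, L₀ is induced.
      w-then-L₀ : ∀ {e u} → WhiteEdge e u i → ¬ InC u → InducedPath (w e ∷ L₀)
      w-then-L₀ {e} e∶u-i u∉C =
        w-sees e (x i') (inject₁ i') (x-loc i')
          (subst (λ v → (v ≡ a e) ⊎ (v ≡ b e)) (sym i'↑) (proj₂ (white-ends e∶u-i))) ,
        part-≢-w (x-loc i') ∘ sym ,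
        B-apart-C-path (w∈ a∉C b∉C) , L₀-induced
        where
        a∉C = proj₁ (white-outside-C e∶u-i u∉C i∉C)
        b∉C = proj₂ (white-outside-C e∶u-i u∉C i∉C)

      white-miss : ∀ {e u u'} → WhiteEdge e u u' → ¬ InC u → ¬ InC u' → Miss (w e)
      white-miss e∶u-u' u∉C u'∉C = let (a∉C , b∉C) = white-outside-C e∶u-u' u∉C u'∉C in w-miss a∉C b∉C

      y-w-apart : ∀ {e u u' q} → WhiteEdge e u u' → q ≢ u → q ≢ u' → Apart (y q) (w e)
      y-w-apart {e} {q = q} e∶u-u' q≢u q≢u' =
        let (q≢a , q≢b) = white-other e∶u-u' q≢u q≢u' in Apart-sym (w-apart e (y q) q (y-loc q) q≢a q≢b)

      white-case : FirstHit 0ℙ L₀ → WhiteAccess j → ⊥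
      white-case fh (direct e e∶j-i) =
        no-odd-hit-from-yj (w e) L₀
          (y-w-adj e j (proj₁ (white-ends e∶j-i)) , part-≢-w (y-loc j) , y-apart-L₀ j∈B , w-then-L₀ e∶j-i j∉C)
          (part-≢-w z∈s) (miss (white-miss e∶j-i j∉C i∉C) fh)
        where j∉C = B⇒¬C j∈B
      white-case fh (two-step e1 e2 v1 v1∈B v1≢j e1∶v1-j e2∶v1-i) =
        no-odd-hit-from-yj (w e1) (y v1 ∷ w e2 ∷ L₀) path (part-≢-w z∈s)
          (miss (white-miss e1∶v1-j v1∉C j∉C) (firstHit-cons (y v1) (miss (white-miss e2∶v1-i v1∉C i∉C) fh)))
        where
        j∉C = B⇒¬C j∈B
        v1∉C = B⇒¬C v1∈B
        e1≢e2 : e1 ≢ e2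
        e1≢e2 refl = j≢i (white-determined e1∶v1-j e2∶v1-i v1≢j)
        i'≢v1 : inject₁ i' ≢ v1
        i'≢v1 i'≡v1 = B≢i v1∈B (trans (sym i'≡v1) i'↑)
        i'≢j : inject₁ i' ≢ j
        i'≢j i'≡j = j≢i (trans (sym i'≡j) i'↑)
        i'≢a = proj₁ (white-other e1∶v1-j i'≢v1 i'≢j)
        i'≢b = proj₂ (white-other e1∶v1-j i'≢v1 i'≢j)
        e1∉C = white-outside-C e1∶v1-j v1∉C j∉C
        path : InducedPath (y j ∷ w e1 ∷ y v1 ∷ w e2 ∷ L₀)
        path = y-w-adj e1 j (proj₂ (white-ends e1∶v1-j)) , part-≢-w (y-loc j) ,
               y-y-apart j v1 (v1≢j ∘ sym) ∷ y-w-apart e2∶v1-i (v1≢j ∘ sym) j≢i ∷ y-apart-L₀ j∈B ,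
               w-sees e1 (y v1) v1 (y-loc v1) (proj₁ (white-ends e1∶v1-j)) , part-≢-w (y-loc v1) ∘ sym ,
               w-w-apart e1 e2 e1≢e2 ∷ w-apart e1 (x i') (inject₁ i') (x-loc i') i'≢a i'≢b ∷
               B-apart-C-path (w∈ (proj₁ e1∉C) (proj₂ e1∉C)) ,
               y-w-adj e2 v1 (proj₁ (white-ends e2∶v1-i)) , part-≢-w (y-loc v1) , y-apart-L₀ v1∈B ,
               w-then-L₀ e2∶v1-i v1∉C

      impossible : IsBiSpiderOn (λ u → side u ≢ sY) → ⊥
      impossible spider with first-hit-L₀
      ... | 1ℙ , fh = red-case fh refl chain (chain-simple chain)
        where chain = red-chain-from j (B⇒¬C j∈B)
      ... | 0ℙ , fh = white-case fh (spider-access spider j∈B j≢i)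

lemma8 : (k : ℕ) (σ : Setting k) → EvenHoleFree (Setting.G σ) → (Y : YSet σ) →
    (i : Fin (suc k)) (side : Fin (suc k) → BiTree.Side k (Setting.a σ) (Setting.b σ) (Setting.r σ)) →
    BiTree.IsSeparation k (Setting.a σ) (Setting.b σ) (Setting.r σ) i side →
    side (fromℕ k) ≡ BiTree.sY →
    BiTree.IsBiSpiderOn k (Setting.a σ) (Setting.b σ) (Setting.r σ) (λ u → side u ≢ BiTree.sY) →
    (EdgeSys.IsLeafOn {suc k} {k} inject₁ (Setting.r σ) (λ u → side u ≢ BiTree.sX) i
      ⊎ EdgeSys.IsLeafOn (Setting.a σ) (Setting.b σ) (λ u → side u ≢ BiTree.sX) i) →
    ∀ j → side j ≡ BiTree.sX → j ≢ i → ∀ s → side s ≡ BiTree.sY →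
    ∀ z → Setting.loc σ z ≡ inj₁ s → Setting.adj σ (YSet.y Y j) z ≡ false
lemma8 k σ ehf Y i side sep root∈C spider leaf j j∈B j≢i s s∈C z z∈s
  with Setting.adj σ (YSet.y Y j) z in yj·z
... | false = refl
... | true  = ⊥-elim (impossible spider)
  where open Separation.InGraph.Contradiction σ i side sep root∈C Y ehf leaf j j∈B j≢i s s∈C z z∈s yj·z
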